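{- For $k \geq 2$, every $k$-geodetic digraph with order $n$ contains a vertex with out-degree at most $n^{1/k}$.
   Context: A digraph has a vertex set and an arc set consisting of ordered pairs of distinct vertices. A walk of length $\ell$ is a sequence $x_0x_1\dots x_\ell$ of vertices with $x_i \rightarrow x_{i+1}$ for all $i$. A digraph is $k$-geodetic if for every ordered pair $(u,v)$ of (not necessarily distinct) vertices there is at most one $u,v$-walk of length at most $k$. -}

module Defs where

open import Data.Nat using (ℕ; suc; _≤_)
open import Data.Bool using (Bool; T; false)
open import Data.Fin using (Fin)
open import Data.List using (List; []; _∷_; length; filter; allFin)
open import Relation.Nullary.Decidable using (T?)
open import Relation.Binary.PropositionalEquality using (_≡_)

record Digraph (n : ℕ) : Set where
  field
    arc      : Fin n → Fin n → Bool
    loopless : ∀ u → arc u u ≡ false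
open Digraph public

-- WalkFrom D u v xs : the vertex sequence  u ∷ xs  is a walk in D from u to v.
-- Its length is  length xs  (number of arcs).
data WalkFrom {n : ℕ} (D : Digraph n) : Fin n → Fin n → List (Fin n) → Set where
  nil  : ∀ {u} → WalkFrom D u u []
  cons : ∀ {u w v xs} → T (arc D u w) → WalkFrom D w v xs → WalkFrom D u v (w ∷ xs)

IsGeodetic : {n : ℕ} → ℕ → Digraph n → Set
IsGeodetic {n} k D =
  ∀ (u v : Fin n) (xs ys : List (Fin n)) →
  WalkFrom D u v xs → WalkFrom D u v ys →
  length xs ≤ k → length ys ≤ k → xs ≡ ys

outDeg : {n : ℕ} → Digraph n → Fin n → ℕ
outDeg {n} D u = length (filter (λ v → T? (arc D u v)) (allFin n))

-- Let d be the minimum out-degree and u a vertex attaining it. Every sequence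
-- of k choices among d out-neighbours traces a walk of length k from u, and
-- distinct choice sequences trace distinct walks. In a k-geodetic digraph two
-- distinct walks of length k from u cannot share their last vertex, so the d^k
-- choice sequences inject into the vertex set.
module Submission where

open import Defs
open import Data.Nat using (ℕ; _≤_; _^_)
open import Data.Fin using (Fin)
open import Data.Product using (∃)

open import Data.Nat using (zero; suc)
open import Data.Nat.Properties using (≤-reflexive; ≤-totalOrder)
open import Data.Fin using (zero; suc; inject≤; combine; funToFin; finToFun)
open import Data.Fin.Properties using (inject≤-injective; injective⇒≤; funToFin-finToFin)
open import Data.List using (List; []; _∷_; length; lookup; filter; allFin)
open import Data.List.Properties using (∷-injectiveˡ; ∷-injectiveʳ)
import Data.List.Relation.Unary.All as All
open import Data.List.Relation.Unary.AllPairs using (_∷_)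
open import Data.List.Relation.Unary.Unique.Propositional using (Unique)
open import Data.List.Relation.Unary.Unique.Propositional.Properties using (filter⁺; allFin⁺)
open import Data.List.Membership.Propositional.Properties using (∈-lookup; ∈-filter⁻; ∈-allFin)
open import Data.List.Extrema ≤-totalOrder using (argmin; f[argmin]≤f[xs])
open import Data.Bool using (T)
open import Data.Product using (_,_; proj₂)
open import Function using (_∘_)
open import Relation.Nullary using (contradiction)
open import Relation.Nullary.Decidable using (T?)
open import Relation.Binary.PropositionalEquality using (_≡_; _≗_; refl; sym; cong; cong₂; subst; module ≡-Reasoning)

lookup-injective : ∀ {a} {A : Set a} {xs : List A} → Unique xs →
                   ∀ {i j} → lookup xs i ≡ lookup xs j → i ≡ j
lookup-injective (_ ∷ _)    {zero}  {zero}  _  = refl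
lookup-injective (x∉ ∷ _)   {zero}  {suc j} eq = contradiction eq (All.lookup x∉ (∈-lookup j))
lookup-injective (x∉ ∷ _)   {suc i} {zero}  eq = contradiction (sym eq) (All.lookup x∉ (∈-lookup i))
lookup-injective (_ ∷ uniq) {suc i} {suc j} eq = cong suc (lookup-injective uniq eq)

funToFin-cong : ∀ {m n} {f g : Fin m → Fin n} → f ≗ g → funToFin f ≡ funToFin g
funToFin-cong {zero}  _   = refl
funToFin-cong {suc m} f≗g = cong₂ combine (f≗g zero) (funToFin-cong (f≗g ∘ suc))

finToFun-injective : ∀ {m n} {a b : Fin (m ^ n)} → finToFun {m} {n} a ≗ finToFun b → a ≡ b
finToFun-injective {m} {n} {a} {b} eq = begin
  a                                 ≡⟨ funToFin-finToFin {n} {m} a ⟨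
  funToFin {n} {m} (finToFun a)     ≡⟨ funToFin-cong eq ⟩
  funToFin {n} {m} (finToFun b)     ≡⟨ funToFin-finToFin {n} {m} b ⟩
  b                                 ∎
  where open ≡-Reasoning

minimiser : ∀ {m} (f : Fin (suc m) → ℕ) → ∃ λ u → ∀ w → f u ≤ f w
minimiser f = argmin f zero (allFin _) ,
              λ w → All.lookup (f[argmin]≤f[xs] {f = f} zero (allFin _)) (∈-allFin w)

module _ {n : ℕ} (D : Digraph n) where

  outNeighbours : Fin n → List (Fin n)
  outNeighbours u = filter (λ v → T? (arc D u v)) (allFin n)

  outNeighbour : ∀ u → Fin (outDeg D u) → Fin n
  outNeighbour u = lookup (outNeighbours u)

  outNeighbour-arc : ∀ u i → T (arc D u (outNeighbour u i))
  outNeighbour-arc u i = proj₂ (∈-filter⁻ (λ v → T? (arc D u v)) {xs = allFin n} (∈-lookup i))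

  outNeighbour-injective : ∀ u {i j} → outNeighbour u i ≡ outNeighbour u j → i ≡ j
  outNeighbour-injective u = lookup-injective (filter⁺ (λ v → T? (arc D u v)) (allFin⁺ n))

  module Routes {d : ℕ} (d≤outDeg : ∀ w → d ≤ outDeg D w) where

    step : Fin n → Fin d → Fin n
    step u i = outNeighbour u (inject≤ i (d≤outDeg u))

    step-injective : ∀ u {i j} → step u i ≡ step u j → i ≡ j
    step-injective u {i} {j} = inject≤-injective _ _ i j ∘ outNeighbour-injective u

    route : ∀ {j} → Fin n → (Fin j → Fin d) → List (Fin n)
    route {zero}  u c = []
    route {suc j} u c = step u (c zero) ∷ route (step u (c zero)) (c ∘ suc)

    destination : ∀ {j} → Fin n → (Fin j → Fin d) → Fin n
    destination {zero}  u c = u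
    destination {suc j} u c = destination (step u (c zero)) (c ∘ suc)

    route-walk : ∀ {j} u (c : Fin j → Fin d) → WalkFrom D u (destination u c) (route u c)
    route-walk {zero}  u c = nil
    route-walk {suc j} u c = cons (outNeighbour-arc u _) (route-walk (step u (c zero)) (c ∘ suc))

    length-route : ∀ {j} u (c : Fin j → Fin d) → length (route u c) ≡ j
    length-route {zero}  u c = refl
    length-route {suc j} u c = cong suc (length-route (step u (c zero)) (c ∘ suc))

    route-injective : ∀ {j u v} (c c′ : Fin j → Fin d) → u ≡ v → route u c ≡ route v c′ → c ≗ c′
    route-injective {suc j} {u} c c′ refl eq zero    = step-injective u (∷-injectiveˡ eq)
    route-injective {suc j}     c c′ refl eq (suc i) =
      route-injective (c ∘ suc) (c′ ∘ suc) (∷-injectiveˡ eq) (∷-injectiveʳ eq) i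

    destination-injective : ∀ {k} → IsGeodetic k D → ∀ u (c c′ : Fin k → Fin d) →
                            destination u c ≡ destination u c′ → c ≗ c′
    destination-injective geodetic u c c′ eq = route-injective c c′ refl
      (geodetic u _ (route u c) (route u c′) (route-walk u c)
        (subst (λ v → WalkFrom D u v (route u c′)) (sym eq) (route-walk u c′))
        (≤-reflexive (length-route u c)) (≤-reflexive (length-route u c′)))

  geodetic⇒minOutDeg^k≤n : ∀ {k d} → IsGeodetic k D → (∀ w → d ≤ outDeg D w) → Fin n → d ^ k ≤ n
  geodetic⇒minOutDeg^k≤n {k} {d} geodetic d≤outDeg u =
    injective⇒≤ {f = destination u ∘ finToFun {d} {k}}
                (finToFun-injective ∘ destination-injective geodetic u _ _)
    where open Routes d≤outDeg

-- The bound holds for every k.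
lemma25 : (k n : ℕ) → 2 ≤ k → 1 ≤ n → (D : Digraph n) → IsGeodetic k D →
    ∃ λ (u : Fin n) → outDeg D u ^ k ≤ n
lemma25 k (suc m) _ _ D geodetic =
  let (u , minimal) = minimiser (outDeg D) in
  u , geodetic⇒minOutDeg^k≤n D geodetic minimal u
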